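{- Let $G$ be a graph and let $f$ be a vertex-arithmetic IASI of $G$ such that any two adjacent vertices of $G$ have distinct deterministic indices. Then $f$ is edge-arithmetic if and only if for every pair of adjacent vertices $u,v$ of $G$, the deterministic index of one of them, say $v$, equals $k$ times the deterministic index of the other, $u$, for some positive integer $k$ with $k\le |f(u)|$.
   Context: All graphs are simple, finite and have no isolated vertices. $\mathbb{N}_0$ is the set of non-negative integers; all sets considered are finite. For $A,B\subseteq\mathbb{N}_0$, $A+B=\{a+b: a\in A, b\in B\}$. An integer additive set-indexer (IASI) of $G$ is an injective function $f:V(G)\to 2^{\mathbb{N}_0}$ such that the induced function $f^+:E(G)\to 2^{\mathbb{N}_0}$, $f^+(uv)=f(u)+f(v)$, is also injective. An AP-set is a finite set of non-negative integers whose elements, in increasing order, form an arithmetic progression; its common difference is called the deterministic index of the element (vertex or edge) it labels. An IASI $f$ is vertex-arithmetic if $f(v)$ is an AP-set for every vertex $v$, and edge-arithmetic if $f^+(e)$ is an AP-set for every edge $e$. -}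

module Defs where

open import Data.Nat using (ℕ; zero; suc; _+_; _*_; _≤_; _≟_)
open import Data.Fin using (Fin)
open import Data.List using (List; map; concatMap; upTo; length; deduplicate)
open import Data.List.Membership.Propositional using (_∈_)
open import Data.Product using (_×_; Σ; ∃; ∃-syntax; _,_)
open import Data.Sum using (_⊎_)
open import Relation.Nullary using (¬_)
open import Relation.Binary.PropositionalEquality using (_≡_; _≢_)

-- A finite subset of ℕ₀, represented by a list of its elements
-- (repetitions and order irrelevant).
FinSet : Set
FinSet = List ℕ

_≈ˢ_ : FinSet → FinSet → Set
A ≈ˢ B = ∀ x → (x ∈ A → x ∈ B) × (x ∈ B → x ∈ A)

card : FinSet → ℕ
card A = length (deduplicate _≟_ A)

_+ˢ_ : FinSet → FinSet → FinSet
A +ˢ B = concatMap (λ a → map (λ b → a + b) B) A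

apList : ℕ → ℕ → ℕ → FinSet
apList a d m = map (λ i → a + i * d) (upTo m)

IsAPWith : ℕ → FinSet → Set
IsAPWith d S = Σ ℕ λ a → Σ ℕ λ m → (2 ≤ m) × (1 ≤ d) × (S ≈ˢ apList a d m)

IsAP : FinSet → Set
IsAP S = ∃[ d ] IsAPWith d S

record Graph : Set₁ where
  field
    n        : ℕ
    Adj      : Fin n → Fin n → Set
    sym      : ∀ {u v} → Adj u v → Adj v u
    irrefl   : ∀ {u} → ¬ Adj u u
    noIsol   : ∀ u → ∃[ v ] Adj u v

open Graph public

IsIASI : (G : Graph) → (Fin (n G) → FinSet) → Set
IsIASI G f =
  (∀ u v → f u ≈ˢ f v → u ≡ v) ×
  (∀ {u v x y} → Adj G u v → Adj G x y → (f u +ˢ f v) ≈ˢ (f x +ˢ f y) →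
      (u ≡ x × v ≡ y) ⊎ (u ≡ y × v ≡ x))

VertexArithmetic : (G : Graph) → (Fin (n G) → FinSet) → Set
VertexArithmetic G f = ∀ v → IsAP (f v)

EdgeArithmetic : (G : Graph) → (Fin (n G) → FinSet) → Set
EdgeArithmetic G f = ∀ {u v} → Adj G u v → IsAP (f u +ˢ f v)

-- Write f u = {a + i d : i < m} and f v = {b + j d′ : j < p} with d < d′, so that
-- f u + f v = {a + b + (i d + j d′)}. If d′ = k d with k ≤ m, the translates of f u by
-- the multiples j d′ overlap or abut, and the sumset is the AP-set starting at a + b with
-- difference d and m + (p − 1) k terms. Conversely, if the sumset is an AP-set, its two
-- smallest elements are a + b and a + b + d, so its difference is d; since a + b + d′ lies
-- in it, d′ = k d with k ≥ 1, and if k > m the term a + b + m d would lie in it too,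
-- although m is not of the form i + j k with i < m.
module Submission where

open import Defs hiding (sym)
open import Data.Nat using (ℕ; zero; suc; _+_; _*_; _∸_; _≤_; _<_; z≤n; s≤s; _≟_; _≤?_; >-nonZero)
open import Data.Nat.Properties
open import Algebra.Properties.CommutativeSemigroup +-commutativeSemigroup using (interchange; x∙yz≈y∙xz)
open import Data.Fin using (Fin)
open import Data.List using (map; upTo; length; deduplicate)
open import Data.List.Properties using (length-map; length-upTo)
open import Data.List.Membership.Propositional using (_∈_; find; lose)
open import Data.List.Membership.Propositional.Properties
  using (∈-map⁺; ∈-map⁻; ∈-concatMap⁺; ∈-concatMap⁻; ∈-upTo⁺; ∈-upTo⁻; ∈-deduplicate⁺; ∈-deduplicate⁻)
open import Data.List.Membership.Propositional.Properties.WithK using (unique∧set⇒bag)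
open import Data.List.Relation.Binary.BagAndSetEquality using (∼bag⇒↭)
open import Data.List.Relation.Binary.Permutation.Propositional.Properties using (↭-length)
open import Data.List.Relation.Binary.Subset.Propositional using (_⊆_)
open import Data.List.Relation.Binary.Subset.Propositional.Properties using (⊆-trans)
open import Data.List.Relation.Unary.Unique.Propositional using (Unique)
open import Data.List.Relation.Unary.Unique.DecPropositional.Properties _≟_ using (deduplicate-!)
import Data.List.Relation.Unary.Unique.Propositional.Properties as Unique
open import Data.Product using (_×_; Σ; ∃; ∃₂; _,_; proj₁; proj₂)
open import Data.Sum using (_⊎_; inj₁; inj₂)
open import Data.Empty using (⊥-elim)
open import Relation.Nullary using (yes; no)
open import Relation.Binary using (tri<; tri≈; tri>)
open import Function.Bundles using (_⇔_; mk⇔; Equivalence)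
open import Relation.Binary.PropositionalEquality

∈-apList⁻ : ∀ {a d m x} → x ∈ apList a d m → ∃ λ i → i < m × x ≡ a + i * d
∈-apList⁻ x∈ with ∈-map⁻ _ x∈
... | i , i∈ , x≡ = i , ∈-upTo⁻ i∈ , x≡

∈-apList⁺ : ∀ {a d m i} → i < m → a + i * d ∈ apList a d m
∈-apList⁺ i<m = ∈-map⁺ _ (∈-upTo⁺ i<m)

∈-+ˢ⁻ : ∀ A B {x} → x ∈ A +ˢ B → ∃₂ λ a b → a ∈ A × b ∈ B × x ≡ a + b
∈-+ˢ⁻ A B x∈ with find (∈-concatMap⁻ (λ a → map (a +_) B) {xs = A} x∈)
... | a , a∈ , x∈a+B with ∈-map⁻ _ x∈a+B
... | b , b∈ , x≡ = a , b , a∈ , b∈ , x≡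

∈-+ˢ⁺ : ∀ {A} B {a b} → a ∈ A → b ∈ B → a + b ∈ A +ˢ B
∈-+ˢ⁺ {A} B a∈ b∈ = ∈-concatMap⁺ (λ a → map (a +_) B) {xs = A} (lose a∈ (∈-map⁺ _ b∈))

mk≈ˢ : ∀ {A B} → A ⊆ B → B ⊆ A → A ≈ˢ B
mk≈ˢ A⊆B B⊆A _ = A⊆B , B⊆A

≈ˢ⇒⊆ : ∀ {A B} → A ≈ˢ B → A ⊆ B
≈ˢ⇒⊆ A≈B = proj₁ (A≈B _)

≈ˢ⇒⊇ : ∀ {A B} → A ≈ˢ B → B ⊆ A
≈ˢ⇒⊇ A≈B = proj₂ (A≈B _)

≈ˢ-sym : ∀ {A B} → A ≈ˢ B → B ≈ˢ A
≈ˢ-sym A≈B = mk≈ˢ (≈ˢ⇒⊇ A≈B) (≈ˢ⇒⊆ A≈B)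

≈ˢ-trans : ∀ {A B C} → A ≈ˢ B → B ≈ˢ C → A ≈ˢ C
≈ˢ-trans A≈B B≈C = mk≈ˢ (⊆-trans (≈ˢ⇒⊆ A≈B) (≈ˢ⇒⊆ B≈C)) (⊆-trans (≈ˢ⇒⊇ B≈C) (≈ˢ⇒⊇ A≈B))

+ˢ-mono-⊆ : ∀ {A A′ B B′} → A ⊆ A′ → B ⊆ B′ → A +ˢ B ⊆ A′ +ˢ B′
+ˢ-mono-⊆ {A} {B = B} {B′} A⊆A′ B⊆B′ x∈ with ∈-+ˢ⁻ A B x∈
... | _ , _ , a∈ , b∈ , refl = ∈-+ˢ⁺ B′ (A⊆A′ a∈) (B⊆B′ b∈)

+ˢ-cong : ∀ {A A′ B B′} → A ≈ˢ A′ → B ≈ˢ B′ → (A +ˢ B) ≈ˢ (A′ +ˢ B′)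
+ˢ-cong A≈A′ B≈B′ = mk≈ˢ (+ˢ-mono-⊆ (≈ˢ⇒⊆ A≈A′) (≈ˢ⇒⊆ B≈B′)) (+ˢ-mono-⊆ (≈ˢ⇒⊇ A≈A′) (≈ˢ⇒⊇ B≈B′))

+ˢ-comm-⊆ : ∀ A B → A +ˢ B ⊆ B +ˢ A
+ˢ-comm-⊆ A B x∈ with ∈-+ˢ⁻ A B x∈
... | a , b , a∈ , b∈ , refl = subst (_∈ B +ˢ A) (+-comm b a) (∈-+ˢ⁺ A b∈ a∈)

+ˢ-comm : ∀ A B → (A +ˢ B) ≈ˢ (B +ˢ A)
+ˢ-comm A B = mk≈ˢ (+ˢ-comm-⊆ A B) (+ˢ-comm-⊆ B A)

IsAPWith-resp-≈ˢ : ∀ {d A B} → A ≈ˢ B → IsAPWith d A → IsAPWith d B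
IsAPWith-resp-≈ˢ A≈B (a , m , 2≤m , 1≤d , A≈ap) = a , m , 2≤m , 1≤d , ≈ˢ-trans (≈ˢ-sym A≈B) A≈ap

IsAP-resp-≈ˢ : ∀ {A B} → A ≈ˢ B → IsAP A → IsAP B
IsAP-resp-≈ˢ A≈B (d , A-AP) = d , IsAPWith-resp-≈ˢ A≈B A-AP

apList-unique : ∀ {a d} m → 1 ≤ d → Unique (apList a d m)
apList-unique {a} {d} m 1≤d = Unique.map⁺ injective (Unique.upTo⁺ m)
  where
  injective : ∀ {i j} → a + i * d ≡ a + j * d → i ≡ j
  injective {i} {j} eq = *-cancelʳ-≡ i j d ⦃ >-nonZero 1≤d ⦄ (+-cancelˡ-≡ a _ _ eq)

card-apList : ∀ {A a d m} → 1 ≤ d → A ≈ˢ apList a d m → card A ≡ m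
card-apList {A} {a} {d} {m} 1≤d A≈ap = begin
  card A                ≡⟨ ↭-length (∼bag⇒↭ (unique∧set⇒bag (deduplicate-! A) (apList-unique m 1≤d) same-set)) ⟩
  length (apList a d m) ≡⟨ length-map _ (upTo m) ⟩
  length (upTo m)       ≡⟨ length-upTo m ⟩
  m                     ∎
  where
  open ≡-Reasoning
  same-set : ∀ {x} → (x ∈ deduplicate _≟_ A) ⇔ (x ∈ apList a d m)
  same-set = mk⇔ (λ x∈ → ≈ˢ⇒⊆ A≈ap (∈-deduplicate⁻ _≟_ A x∈)) (λ x∈ → ∈-deduplicate⁺ _≟_ (≈ˢ⇒⊇ A≈ap x∈))

module _ {a d m b d′ p : ℕ} where

  ∈-apList-+ˢ⁻ : ∀ {x} → x ∈ apList a d m +ˢ apList b d′ p →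
                 ∃₂ λ i j → i < m × j < p × x ≡ (a + b) + (i * d + j * d′)
  ∈-apList-+ˢ⁻ x∈ with ∈-+ˢ⁻ (apList a d m) (apList b d′ p) x∈
  ... | _ , _ , y∈ , z∈ , refl with ∈-apList⁻ y∈ | ∈-apList⁻ z∈
  ... | i , i<m , refl | j , j<p , refl = i , j , i<m , j<p , interchange a (i * d) b (j * d′)

  ∈-apList-+ˢ⁺ : ∀ {i j} → i < m → j < p → (a + b) + (i * d + j * d′) ∈ apList a d m +ˢ apList b d′ p
  ∈-apList-+ˢ⁺ {i} {j} i<m j<p = subst (_∈ apList a d m +ˢ apList b d′ p) (interchange a (i * d) b (j * d′))
    (∈-+ˢ⁺ (apList b d′ p) (∈-apList⁺ i<m) (∈-apList⁺ j<p))

-- The windows [j k, j k + m) for j ≤ q cover [0, m + q k) because k ≤ m.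
cover-by-windows : ∀ {k m} → k ≤ m → ∀ q {t} → t < m + q * k →
                   ∃₂ λ i j → i < m × j ≤ q × t ≡ i + j * k
cover-by-windows k≤m zero {t} t< = t , 0 , subst (t <_) (+-identityʳ _) t< , z≤n , sym (+-identityʳ t)
cover-by-windows {k} {m} k≤m (suc q) {t} t< with k ≤? t
... | no k≰t = t , 0 , <-≤-trans (≰⇒> k≰t) k≤m , z≤n , sym (+-identityʳ t)
... | yes k≤t with cover-by-windows k≤m q (+-cancelˡ-< k (t ∸ k) (m + q * k) shifted)
  where
  shifted : k + (t ∸ k) < k + (m + q * k)
  shifted = subst₂ _<_ (sym (m+[n∸m]≡n k≤t)) (x∙yz≈y∙xz m k (q * k)) t<
... | i , j , i<m , j≤q , t∸k≡ = i , suc j , i<m , s≤s j≤q , (begin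
  t                ≡⟨ m+[n∸m]≡n k≤t ⟨
  k + (t ∸ k)      ≡⟨ cong (k +_) t∸k≡ ⟩
  k + (i + j * k)  ≡⟨ x∙yz≈y∙xz k i (j * k) ⟩
  i + (k + j * k)  ∎)
  where open ≡-Reasoning

i*d+j*[k*d]≡[i+j*k]*d : ∀ i j k d → i * d + j * (k * d) ≡ (i + j * k) * d
i*d+j*[k*d]≡[i+j*k]*d i j k d = trans (cong (i * d +_) (sym (*-assoc j k d))) (sym (*-distribʳ-+ d i (j * k)))

apList-+ˢ-apList : ∀ {a d m b k} p → k ≤ m →
  (apList a d m +ˢ apList b (k * d) (suc p)) ≈ˢ apList (a + b) d (m + p * k)
apList-+ˢ-apList {a} {d} {m} {b} {k} p k≤m = mk≈ˢ ⊆ap ap⊆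
  where
  ⊆ap : apList a d m +ˢ apList b (k * d) (suc p) ⊆ apList (a + b) d (m + p * k)
  ⊆ap x∈ with ∈-apList-+ˢ⁻ {a} {d} {m} {b} {k * d} {suc p} x∈
  ... | i , j , i<m , s≤s j≤p , refl =
    subst (_∈ apList (a + b) d (m + p * k)) (cong (a + b +_) (sym (i*d+j*[k*d]≡[i+j*k]*d i j k d)))
      (∈-apList⁺ (+-mono-<-≤ i<m (*-monoˡ-≤ k j≤p)))

  ap⊆ : apList (a + b) d (m + p * k) ⊆ apList a d m +ˢ apList b (k * d) (suc p)
  ap⊆ x∈ with ∈-apList⁻ x∈
  ... | t , t< , refl with cover-by-windows k≤m p t<
  ... | i , j , i<m , j≤p , refl =
    subst (_∈ apList a d m +ˢ apList b (k * d) (suc p)) (cong (a + b +_) (i*d+j*[k*d]≡[i+j*k]*d i j k d))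
      (∈-apList-+ˢ⁺ i<m (s≤s j≤p))

MultipleUpTo : ℕ → ℕ → ℕ → Set
MultipleUpTo m d d′ = Σ ℕ λ k → 1 ≤ k × k ≤ m × d′ ≡ k * d

MultipleUpTo⇒IsAP-+ˢ : ∀ {d d′ A B} → IsAPWith d A → IsAPWith d′ B →
                       MultipleUpTo (card A) d d′ → IsAP (A +ˢ B)
MultipleUpTo⇒IsAP-+ˢ {d} (a , m , 2≤m , 1≤d , A≈) (b , _ , s≤s {n = p} _ , _ , B≈) (k , _ , k≤|A| , refl) =
  d , a + b , m + p * k , ≤-trans 2≤m (m≤m+n m _) , 1≤d ,
  ≈ˢ-trans (+ˢ-cong A≈ B≈) (apList-+ˢ-apList p (subst (k ≤_) (card-apList 1≤d A≈) k≤|A|))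

IsLeast : FinSet → ℕ → Set
IsLeast S x = x ∈ S × (∀ {y} → y ∈ S → x ≤ y)

IsLeastAbove : ℕ → FinSet → ℕ → Set
IsLeastAbove x S y = y ∈ S × x < y × (∀ {z} → z ∈ S → x < z → y ≤ z)

IsLeast-unique : ∀ {S T x y} → S ≈ˢ T → IsLeast S x → IsLeast T y → x ≡ y
IsLeast-unique S≈T (x∈ , x≤) (y∈ , y≤) = ≤-antisym (x≤ (≈ˢ⇒⊇ S≈T y∈)) (y≤ (≈ˢ⇒⊆ S≈T x∈))

IsLeastAbove-unique : ∀ {S T x y z} → S ≈ˢ T → IsLeastAbove x S y → IsLeastAbove x T z → y ≡ z
IsLeastAbove-unique S≈T (y∈ , x<y , y≤) (z∈ , x<z , z≤) =
  ≤-antisym (y≤ (≈ˢ⇒⊇ S≈T z∈) x<z) (z≤ (≈ˢ⇒⊆ S≈T y∈) x<y)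

apList-least : ∀ {a d m} → 1 ≤ m → IsLeast (apList a d m) a
apList-least {a} {d} {m} 1≤m = subst (_∈ apList a d m) (+-identityʳ a) (∈-apList⁺ 1≤m) , a≤
  where
  a≤ : ∀ {y} → y ∈ apList a d m → a ≤ y
  a≤ y∈ with ∈-apList⁻ {a} {d} y∈
  ... | i , _ , refl = m≤m+n a (i * d)

apList-next : ∀ {a d m} → 2 ≤ m → 1 ≤ d → IsLeastAbove a (apList a d m) (a + d)
apList-next {a} {d} {m} 2≤m 1≤d =
  subst (_∈ apList a d m) (cong (a +_) (*-identityˡ d)) (∈-apList⁺ 2≤m) , m<m+n a 1≤d , a+d≤
  where
  a+d≤ : ∀ {z} → z ∈ apList a d m → a < z → a + d ≤ z
  a+d≤ z∈ a<z with ∈-apList⁻ {a} {d} z∈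
  ... | zero , _ , refl = ⊥-elim (<-irrefl (sym (+-identityʳ a)) a<z)
  ... | suc i , _ , refl = +-monoʳ-≤ a (m≤m+n d (i * d))

positive-combination-≥ : ∀ {d d′} i j → d ≤ d′ → 0 < i * d + j * d′ → d ≤ i * d + j * d′
positive-combination-≥ {d} {d′} i (suc j) d≤d′ _ = ≤-trans d≤d′ (≤-trans (m≤m+n d′ (j * d′)) (m≤n+m _ (i * d)))
positive-combination-≥ {d} (suc i) zero _ _ = ≤-trans (m≤m+n d (i * d)) (m≤m+n _ 0)

module _ {a d m b d′ p : ℕ} where

  apList-+ˢ-least : 1 ≤ m → 1 ≤ p → IsLeast (apList a d m +ˢ apList b d′ p) (a + b)
  apList-+ˢ-least 1≤m 1≤p =
    subst (_∈ apList a d m +ˢ apList b d′ p) (+-identityʳ (a + b)) (∈-apList-+ˢ⁺ 1≤m 1≤p) , a+b≤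
    where
    a+b≤ : ∀ {y} → y ∈ apList a d m +ˢ apList b d′ p → a + b ≤ y
    a+b≤ y∈ with ∈-apList-+ˢ⁻ {a} {d} {m} {b} {d′} {p} y∈
    ... | _ , _ , _ , _ , refl = m≤m+n (a + b) _

  apList-+ˢ-next : 2 ≤ m → 1 ≤ p → 1 ≤ d → d ≤ d′ →
                   IsLeastAbove (a + b) (apList a d m +ˢ apList b d′ p) (a + b + d)
  apList-+ˢ-next 2≤m 1≤p 1≤d d≤d′ =
    subst (_∈ apList a d m +ˢ apList b d′ p) (cong (a + b +_) (trans (+-identityʳ _) (*-identityˡ d)))
      (∈-apList-+ˢ⁺ 2≤m 1≤p) ,
    m<m+n (a + b) 1≤d , a+b+d≤
    where
    a+b+d≤ : ∀ {z} → z ∈ apList a d m +ˢ apList b d′ p → a + b < z → a + b + d ≤ z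
    a+b+d≤ z∈ a+b<z with ∈-apList-+ˢ⁻ {a} {d} {m} {b} {d′} {p} z∈
    ... | i , j , _ , _ , refl = +-monoʳ-≤ (a + b) (positive-combination-≥ i j d≤d′
      (+-cancelˡ-< (a + b) 0 (i * d + j * d′)
        (subst (_< a + b + (i * d + j * d′)) (sym (+-identityʳ (a + b))) a+b<z)))

i+j*k≢m : ∀ {i m k} j → i < m → m < k → i + j * k ≢ m
i+j*k≢m {i} zero i<m _ i+0≡m = <-irrefl (trans (sym (+-identityʳ i)) i+0≡m) i<m
i+j*k≢m {i} {m} {k} (suc j) _ m<k i+k+j*k≡m =
  <-irrefl refl (<-≤-trans m<k (subst (k ≤_) i+k+j*k≡m (≤-trans (m≤m+n k (j * k)) (m≤n+m _ i))))

module _ {a d m b d′ p : ℕ} (2≤m : 2 ≤ m) (2≤p : 2 ≤ p) (1≤d : 1 ≤ d) (d<d′ : d < d′) where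

  gap-multiple : ∀ {M} → (apList a d m +ˢ apList b d′ p) ≈ˢ apList (a + b) d M → MultipleUpTo m d d′
  gap-multiple {M} S≈T
    with ∈-apList⁻ {a + b} {d} (≈ˢ⇒⊆ S≈T (∈-apList-+ˢ⁺ {a} {d} {m} {b} {d′} {p} {0} {1} (<⇒≤ 2≤m) 2≤p))
  ... | k , k<M , a+b+d′≡ = k , nonzero k d′≡k*d , k≤m , d′≡k*d
    where
    d′≡k*d : d′ ≡ k * d
    d′≡k*d = trans (sym (+-identityʳ d′)) (+-cancelˡ-≡ (a + b) (d′ + 0) (k * d) a+b+d′≡)

    nonzero : ∀ k → d′ ≡ k * d → 1 ≤ k
    nonzero zero d′≡0 = ⊥-elim (n≮0 (subst (d <_) d′≡0 d<d′))
    nonzero (suc _) _ = s≤s z≤n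

    k≤m : k ≤ m
    k≤m with k ≤? m
    ... | yes k≤m = k≤m
    ... | no k≰m
      with ∈-apList-+ˢ⁻ {a} {d} {m} {b} {d′} {p} (≈ˢ⇒⊇ S≈T (∈-apList⁺ {a + b} {d} {M} {m} (<-trans (≰⇒> k≰m) k<M)))
    ... | i , j , i<m , _ , a+b+m*d≡ = ⊥-elim (i+j*k≢m j i<m (≰⇒> k≰m) (sym m≡i+j*k))
      where
      open ≡-Reasoning
      m≡i+j*k : m ≡ i + j * k
      m≡i+j*k = *-cancelʳ-≡ m (i + j * k) d ⦃ >-nonZero 1≤d ⦄ (begin
        m * d                ≡⟨ +-cancelˡ-≡ (a + b) (m * d) (i * d + j * d′) a+b+m*d≡ ⟩
        i * d + j * d′       ≡⟨ cong (λ e → i * d + j * e) d′≡k*d ⟩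
        i * d + j * (k * d)  ≡⟨ i*d+j*[k*d]≡[i+j*k]*d i j k d ⟩
        (i + j * k) * d      ∎)

  IsAP-apList-+ˢ⇒MultipleUpTo : IsAP (apList a d m +ˢ apList b d′ p) → MultipleUpTo m d d′
  IsAP-apList-+ˢ⇒MultipleUpTo (e , c , M , 2≤M , 1≤e , S≈T)
    with IsLeast-unique S≈T (apList-+ˢ-least (<⇒≤ 2≤m) (<⇒≤ 2≤p)) (apList-least {c} {e} (<⇒≤ 2≤M))
  ... | refl
    with +-cancelˡ-≡ (a + b) d e (IsLeastAbove-unique S≈T
           (apList-+ˢ-next 2≤m (<⇒≤ 2≤p) 1≤d (<⇒≤ d<d′)) (apList-next 2≤M 1≤e))
  ... | refl = gap-multiple S≈T

IsAP-+ˢ⇒MultipleUpTo : ∀ {d d′ A B} → IsAPWith d A → IsAPWith d′ B → d < d′ →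
                       IsAP (A +ˢ B) → MultipleUpTo (card A) d d′
IsAP-+ˢ⇒MultipleUpTo (a , m , 2≤m , 1≤d , A≈) (b , p , 2≤p , _ , B≈) d<d′ A+B-AP
  rewrite card-apList 1≤d A≈ =
  IsAP-apList-+ˢ⇒MultipleUpTo 2≤m 2≤p 1≤d d<d′ (IsAP-resp-≈ˢ (+ˢ-cong A≈ B≈) A+B-AP)

IsAP-+ˢ⇔ : ∀ {d d′ A B} → IsAPWith d A → IsAPWith d′ B → d ≢ d′ →
           IsAP (A +ˢ B) ⇔ (MultipleUpTo (card A) d d′ ⊎ MultipleUpTo (card B) d′ d)
IsAP-+ˢ⇔ {d} {d′} {A} {B} A-AP B-AP d≢d′ = mk⇔ to from
  where
  to : IsAP (A +ˢ B) → MultipleUpTo (card A) d d′ ⊎ MultipleUpTo (card B) d′ d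
  to A+B-AP with <-cmp d d′
  ... | tri< d<d′ _ _ = inj₁ (IsAP-+ˢ⇒MultipleUpTo A-AP B-AP d<d′ A+B-AP)
  ... | tri≈ _ d≡d′ _ = ⊥-elim (d≢d′ d≡d′)
  ... | tri> _ _ d′<d = inj₂ (IsAP-+ˢ⇒MultipleUpTo B-AP A-AP d′<d (IsAP-resp-≈ˢ (+ˢ-comm A B) A+B-AP))

  from : MultipleUpTo (card A) d d′ ⊎ MultipleUpTo (card B) d′ d → IsAP (A +ˢ B)
  from (inj₁ d′-multiple) = MultipleUpTo⇒IsAP-+ˢ A-AP B-AP d′-multiple
  from (inj₂ d-multiple) = IsAP-resp-≈ˢ (+ˢ-comm B A) (MultipleUpTo⇒IsAP-+ˢ B-AP A-AP d-multiple)

proposition2p7 : (G : Graph) (f : Fin (n G) → FinSet) → IsIASI G f →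
    (dix : Fin (n G) → ℕ) → (∀ v → IsAPWith (dix v) (f v)) →
    (∀ {u v} → Adj G u v → dix u ≢ dix v) →
    (EdgeArithmetic G f ⇔
      (∀ {u v} → Adj G u v →
        (Σ ℕ λ k → 1 ≤ k × k ≤ card (f u) × dix v ≡ k * dix u) ⊎
        (Σ ℕ λ k → 1 ≤ k × k ≤ card (f v) × dix u ≡ k * dix v)))
proposition2p7 G f _ dix f-AP adj⇒dix≢ = mk⇔
  (λ edge-AP {u} {v} uv → Equivalence.to (per-edge uv) (edge-AP {u} {v} uv))
  (λ multiple {u} {v} uv → Equivalence.from (per-edge uv) (multiple uv))
  where
  per-edge : ∀ {u v} → Adj G u v → IsAP (f u +ˢ f v) ⇔
             (MultipleUpTo (card (f u)) (dix u) (dix v) ⊎ MultipleUpTo (card (f v)) (dix v) (dix u))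
  per-edge uv = IsAP-+ˢ⇔ (f-AP _) (f-AP _) (adj⇒dix≢ uv)
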